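{- If $G$ and $H$ are finite simple graphs, then \[\mathrm{gp}^-(G\vee H)=\min\{\omega^-(G)+\omega^-(H),\ \alpha^{\omega^- }(G),\ \alpha^{\omega^- }(H)\}.\]
   Context: $G\vee H$ is the join of $G$ and $H$ (disjoint union plus all edges between $V(G)$ and $V(H)$); $G$, $H$ need not be connected. $\omega^-(G)$ is the number of vertices in a smallest maximal (by inclusion) clique of $G$. A set $S\subseteq V(G)$ is an independent union of cliques if every component of the induced subgraph $G[S]$ is a clique; $\alpha^{\omega^- }(G)$ is the number of vertices in a smallest set that is an independent union of at least two cliques and is maximal by inclusion among independent unions of cliques (a single clique is not counted as an independent union of cliques here); if no such set exists the corresponding term is omitted from the minimum. A set $S$ of vertices of a connected graph is a general position set if no shortest path contains three or more vertices of $S$; it is maximal if not properly contained in another general position set; $\mathrm{gp}^-$ denotes the number of vertices in a smallest maximal general position set. -}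

module Defs where

open import Data.Nat using (ℕ; zero; suc; _+_; _≤_)
open import Data.Fin using (Fin; splitAt)
open import Data.Fin.Subset using (Subset; _∈_; _⊂_; ∣_∣)
open import Data.Bool using (Bool; true; false; T)
open import Data.Sum using (_⊎_; inj₁; inj₂)
open import Data.Product using (Σ; ∃; _×_; _,_)
open import Data.Empty using (⊥)
open import Relation.Nullary using (¬_)
open import Relation.Binary.PropositionalEquality using (_≡_; refl)

record Graph (n : ℕ) : Set where
  field
    adj    : Fin n → Fin n → Bool
    sym    : ∀ i j → adj i j ≡ adj j i
    irrefl : ∀ i → adj i i ≡ false
open Graph public

Adj : ∀ {n} → Graph n → Fin n → Fin n → Set
Adj G i j = T (adj G i j)

-- Join of G and H: vertices Fin (n + m), first n from G, last m from H.
module _ {n m : ℕ} (G : Graph n) (H : Graph m) where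
  joinAdj : Fin n ⊎ Fin m → Fin n ⊎ Fin m → Bool
  joinAdj (inj₁ a) (inj₁ b) = adj G a b
  joinAdj (inj₂ a) (inj₂ b) = adj H a b
  joinAdj (inj₁ a) (inj₂ b) = true
  joinAdj (inj₂ a) (inj₁ b) = true

  joinAdj-sym : ∀ x y → joinAdj x y ≡ joinAdj y x
  joinAdj-sym (inj₁ a) (inj₁ b) = sym G a b
  joinAdj-sym (inj₂ a) (inj₂ b) = sym H a b
  joinAdj-sym (inj₁ a) (inj₂ b) = refl
  joinAdj-sym (inj₂ a) (inj₁ b) = refl

  joinAdj-irr : ∀ x → joinAdj x x ≡ false
  joinAdj-irr (inj₁ a) = irrefl G a
  joinAdj-irr (inj₂ a) = irrefl H a

_∨G_ : ∀ {n m} → Graph n → Graph m → Graph (n + m)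
_∨G_ {n} {m} G H = record
  { adj    = λ i j → joinAdj G H (splitAt n i) (splitAt n j)
  ; sym    = λ i j → joinAdj-sym G H (splitAt n i) (splitAt n j)
  ; irrefl = λ i → joinAdj-irr G H (splitAt n i) }

data Walk {n : ℕ} (R : Fin n → Fin n → Set) : Fin n → Fin n → Set where
  []  : ∀ {u} → Walk R u u
  _∷_ : ∀ {u v w} → R u v → Walk R v w → Walk R u w

len : ∀ {n} {R : Fin n → Fin n → Set} {u v} → Walk R u v → ℕ
len []       = 0
len (_ ∷ p)  = suc (len p)

data OnWalk {n : ℕ} {R : Fin n → Fin n → Set} (x : Fin n) : ∀ {u v} → Walk R u v → Set where
  here  : ∀ {v} {p : Walk R x v} → OnWalk x p
  there : ∀ {u v w} {e : R u v} {p : Walk R v w} → OnWalk x p → OnWalk x (e ∷ p)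

Shortest : ∀ {n} (G : Graph n) {u v} → Walk (Adj G) u v → Set
Shortest G {u} {v} p = ∀ (q : Walk (Adj G) u v) → len p ≤ len q

IsGP : ∀ {n} → Graph n → Subset n → Set
IsGP G S = ∀ {u v} (p : Walk (Adj G) u v) → Shortest G p →
  ∀ x y z → x ∈ S → y ∈ S → z ∈ S → ¬ x ≡ y → ¬ y ≡ z → ¬ x ≡ z →
  OnWalk x p → OnWalk y p → OnWalk z p → ⊥

IsMaximalGP : ∀ {n} → Graph n → Subset n → Set
IsMaximalGP G S = IsGP G S × (∀ T → S ⊂ T → ¬ IsGP G T)

IsClique : ∀ {n} → Graph n → Subset n → Set
IsClique G S = ∀ x y → x ∈ S → y ∈ S → ¬ x ≡ y → Adj G x y

IsMaximalClique : ∀ {n} → Graph n → Subset n → Set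
IsMaximalClique G S = IsClique G S × (∀ T → S ⊂ T → ¬ IsClique G T)

InducedAdj : ∀ {n} → Graph n → Subset n → Fin n → Fin n → Set
InducedAdj G S x y = x ∈ S × y ∈ S × Adj G x y

ConnectedIn : ∀ {n} → Graph n → Subset n → Fin n → Fin n → Set
ConnectedIn G S x y = Walk (InducedAdj G S) x y

-- Independent union of cliques: every component of G[S] is a clique,
-- i.e. any two distinct vertices of S in the same component of G[S] are adjacent.
IsUnionOfCliques : ∀ {n} → Graph n → Subset n → Set
IsUnionOfCliques G S = ∀ x y → x ∈ S → y ∈ S → ConnectedIn G S x y → ¬ x ≡ y → Adj G x y

-- ... of at least two cliques: G[S] has at least two components.
IsIUC : ∀ {n} → Graph n → Subset n → Set
IsIUC {n} G S = IsUnionOfCliques G S ×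
  Σ (Fin n) λ x → Σ (Fin n) λ y → x ∈ S × y ∈ S × ¬ ConnectedIn G S x y

IsMaximalIUC : ∀ {n} → Graph n → Subset n → Set
IsMaximalIUC G S = IsIUC G S × (∀ T → S ⊂ T → ¬ IsIUC G T)

IsLeast : (ℕ → Set) → ℕ → Set
IsLeast P k = P k × (∀ j → P j → k ≤ j)

SizeOf : ∀ {n} → (Subset n → Set) → ℕ → Set
SizeOf {n} P k = Σ (Subset n) λ S → P S × ∣ S ∣ ≡ k

IsOmegaMinus : ∀ {n} → Graph n → ℕ → Set
IsOmegaMinus G a = IsLeast (SizeOf (IsMaximalClique G)) a

IsGPMinus : ∀ {n} → Graph n → ℕ → Set
IsGPMinus G g = IsLeast (SizeOf (IsMaximalGP G)) g

-- Both G and H are nonempty, so two distinct non-adjacent vertices of G ∨ H lie on the same side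
-- and have a common neighbour on the other side: G ∨ H has diameter at most two. In such a graph a
-- set is in general position exactly when it induces no P₃, i.e. when it is an independent union
-- of cliques. A set A ∪ B (A ⊆ V(G), B ⊆ V(H)) of G ∨ H induces no P₃ iff A and B do and, when
-- both are nonempty, both are cliques. Hence a maximal general position set is either the union of
-- a maximal clique of G and one of H, or lies on one side, where it must be a maximal independent
-- union of at least two cliques (a clique could still be extended across the join).

module Submission where

open import Defs
open import Data.Bool using (T)
open import Data.Empty using (⊥; ⊥-elim)
import Data.Fin as Fin
open import Data.Fin using (Fin; zero; _≟_; _↑ˡ_; _↑ʳ_; splitAt)
open import Data.Fin.Properties
  using (all?; any?; splitAt-↑ˡ; splitAt-↑ʳ; splitAt⁻¹-↑ˡ; splitAt⁻¹-↑ʳ; ↑ˡ-injective; ↑ʳ-injective)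
open import Data.Fin.Subset
  using (Subset; _∈_; _⊆_; _⊂_; ∣_∣; ⁅_⁆; Nonempty; Empty; inside; outside) renaming (⊥ to ∅)
open import Data.Fin.Subset.Properties
  using (_∈?_; _⊂?_; anySubset?; nonempty?; ⊆-refl; x∈⁅x⁆; x∈⁅y⁆⇒x≡y; ∉⊥; ∣⊥∣≡0)
open import Data.Nat using (ℕ; suc; _+_; _≤_; _<_; z≤n; s≤s) renaming (_≟_ to _≟ℕ_)
open import Data.Nat.Induction using (<-rec)
open import Data.Nat.Properties using (≤-trans; ≮⇒≥; m≤m+n; m≤n+m; +-mono-≤; +-identityʳ; anyUpTo?)
open import Data.Product using (Σ; ∃; ∃₂; _×_; _,_; proj₁; proj₂; map₂)
open import Data.Sum using (_⊎_; inj₁; inj₂)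
open import Data.Unit using (tt)
open import Data.Vec using (_∷_; []; _++_; here; there)
import Data.Vec as Vec
open import Function using (_∘_)
open import Relation.Binary.PropositionalEquality
  using (_≡_; _≢_; refl; trans; cong; cong₂; subst) renaming (sym to ≡-sym)
open import Relation.Nullary using (¬_; Dec; yes; no)
open import Relation.Nullary.Decidable
  using (T?; decidable-stable; map′; _×-dec_; _⊎-dec_; _→-dec_; ¬?)
open import Relation.Unary using (Pred; Decidable)

least : {P : ℕ → Set} → Decidable P → ∀ {k} → P k → Σ ℕ (IsLeast P)
least {P = P} P? {k} = <-rec (λ k → P k → Σ ℕ (IsLeast P)) step k
  where
  step : ∀ k → (∀ {j} → j < k → P j → Σ ℕ (IsLeast P)) → P k → Σ ℕ (IsLeast P)
  step k smaller Pk with anyUpTo? P? k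
  ... | yes (j , j<k , Pj) = smaller j<k Pj
  ... | no none            = k , Pk , λ j Pj → ≮⇒≥ (λ j<k → none (j , j<k , Pj))

IsLeast-transfer : {P Q : ℕ → Set} {g : ℕ} →
  (∀ {k} → P k → Q k) → (∀ {j} → Q j → ∃ λ k → P k × k ≤ j) → IsLeast P g → IsLeast Q g
IsLeast-transfer P⇒Q Q⇒P (Pg , g-least) =
  P⇒Q Pg , λ j Qj → let (k , Pk , k≤j) = Q⇒P Qj in ≤-trans (g-least k Pk) k≤j

module _ {a} {A : Set a} {u v x y z : A} where

  no-three-distinct-in-pair : x ≡ u ⊎ x ≡ v → y ≡ u ⊎ y ≡ v → z ≡ u ⊎ z ≡ v →
                              x ≢ y → y ≢ z → x ≢ z → ⊥
  no-three-distinct-in-pair (inj₁ refl) (inj₁ refl) _           x≢y _   _   = x≢y refl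
  no-three-distinct-in-pair (inj₂ refl) (inj₂ refl) _           x≢y _   _   = x≢y refl
  no-three-distinct-in-pair (inj₁ refl) (inj₂ refl) (inj₁ refl) _   _   x≢z = x≢z refl
  no-three-distinct-in-pair (inj₁ refl) (inj₂ refl) (inj₂ refl) _   y≢z _   = y≢z refl
  no-three-distinct-in-pair (inj₂ refl) (inj₁ refl) (inj₁ refl) _   y≢z _   = y≢z refl
  no-three-distinct-in-pair (inj₂ refl) (inj₁ refl) (inj₂ refl) _   _   x≢z = x≢z refl

module _ {a ℓ} {A : Set a} {Q : Pred A ℓ} {u w v : A} where

  private
    OneOf₃ : A → Set a
    OneOf₃ t = t ≡ u ⊎ t ≡ w ⊎ t ≡ v

    drop-first : ∀ {t} → ¬ Q u → Q t → OneOf₃ t → t ≡ w ⊎ t ≡ v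
    drop-first ¬Qu Qt (inj₁ refl) = ⊥-elim (¬Qu Qt)
    drop-first _   _  (inj₂ t∈wv) = t∈wv

    drop-middle : ∀ {t} → ¬ Q w → Q t → OneOf₃ t → t ≡ u ⊎ t ≡ v
    drop-middle _   _  (inj₁ t≡u)         = inj₁ t≡u
    drop-middle ¬Qw Qt (inj₂ (inj₁ refl)) = ⊥-elim (¬Qw Qt)
    drop-middle _   _  (inj₂ (inj₂ t≡v))  = inj₂ t≡v

    drop-last : ∀ {t} → ¬ Q v → Q t → OneOf₃ t → t ≡ u ⊎ t ≡ w
    drop-last _   _  (inj₁ t≡u)         = inj₁ t≡u
    drop-last _   _  (inj₂ (inj₁ t≡w))  = inj₂ t≡w
    drop-last ¬Qv Qt (inj₂ (inj₂ refl)) = ⊥-elim (¬Qv Qt)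

  three-distinct-fill-triple : Decidable Q → ∀ {x y z} → Q x → Q y → Q z →
                               x ≢ y → y ≢ z → x ≢ z → OneOf₃ x → OneOf₃ y → OneOf₃ z →
                               Q u × Q w × Q v
  three-distinct-fill-triple Q? Qx Qy Qz x≢y y≢z x≢z ox oy oz with Q? u | Q? w | Q? v
  ... | yes Qu | yes Qw | yes Qv = Qu , Qw , Qv
  ... | no ¬Qu | _      | _      = ⊥-elim (no-three-distinct-in-pair
          (drop-first ¬Qu Qx ox) (drop-first ¬Qu Qy oy) (drop-first ¬Qu Qz oz) x≢y y≢z x≢z)
  ... | _      | no ¬Qw | _      = ⊥-elim (no-three-distinct-in-pair
          (drop-middle ¬Qw Qx ox) (drop-middle ¬Qw Qy oy) (drop-middle ¬Qw Qz oz) x≢y y≢z x≢z)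
  ... | _      | _      | no ¬Qv = ⊥-elim (no-three-distinct-in-pair
          (drop-last ¬Qv Qx ox) (drop-last ¬Qv Qy oy) (drop-last ¬Qv Qz oz) x≢y y≢z x≢z)

module _ {n : ℕ} {R : Fin n → Fin n → Set} where

  OnWalk-edge : ∀ {x u v} {e : R u v} → OnWalk {R = R} x (e ∷ []) → x ≡ u ⊎ x ≡ v
  OnWalk-edge here         = inj₁ refl
  OnWalk-edge (there here) = inj₂ refl

  OnWalk-path₂ : ∀ {x u w v} {e : R u w} {f : R w v} →
                 OnWalk {R = R} x (e ∷ f ∷ []) → x ≡ u ⊎ x ≡ w ⊎ x ≡ v
  OnWalk-path₂ here                 = inj₁ refl
  OnWalk-path₂ (there here)         = inj₂ (inj₁ refl)
  OnWalk-path₂ (there (there here)) = inj₂ (inj₂ refl)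

module _ {n : ℕ} {P : Subset n → Set} (P? : Decidable P) where

  Maximal? : Decidable (λ S → P S × (∀ T → S ⊂ T → ¬ P T))
  Maximal? S = P? S ×-dec map′ (λ ∄T T S⊂T PT → ∄T (T , S⊂T , PT))
                               (λ maximal (T , S⊂T , PT) → maximal T S⊂T PT)
                               (¬? (anySubset? λ T → (S ⊂? T) ×-dec P? T))

  SizeOf? : Decidable (SizeOf P)
  SizeOf? k = anySubset? λ S → P? S ×-dec (∣ S ∣ ≟ℕ k)

∅-Empty : ∀ {n} → Empty (∅ {n})
∅-Empty (_ , x∈∅) = ∉⊥ x∈∅

Empty⇒⊂⁅⁆ : ∀ {n} {S : Subset n} (x : Fin n) → Empty S → S ⊂ ⁅ x ⁆
Empty⇒⊂⁅⁆ x empty = (λ y∈S → ⊥-elim (empty (_ , y∈S))) , x , x∈⁅x⁆ x , λ x∈S → empty (x , x∈S)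

module _ {N : ℕ} (G : Graph N) where

  P₃Free : Subset N → Set
  P₃Free S = ∀ {x y z} → x ∈ S → y ∈ S → z ∈ S → x ≢ z → Adj G x y → Adj G y z → Adj G x z

  HasNonAdjacentPair : Subset N → Set
  HasNonAdjacentPair S = ∃₂ λ x y → x ∈ S × y ∈ S × x ≢ y × ¬ Adj G x y

  DiameterTwo : Set
  DiameterTwo = ∀ x y → x ≢ y → ¬ Adj G x y → ∃ λ w → Adj G x w × Adj G w y

  Adj? : ∀ x y → Dec (Adj G x y)
  Adj? x y = T? (adj G x y)

  Adj⇒≢ : ∀ {x y} → Adj G x y → x ≢ y
  Adj⇒≢ {x} xx refl = subst T (irrefl G x) xx

  non-adjacent⇒2≤len : ∀ {x y} → x ≢ y → ¬ Adj G x y → (p : Walk (Adj G) x y) → 2 ≤ len p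
  non-adjacent⇒2≤len x≢y _   []          = ⊥-elim (x≢y refl)
  non-adjacent⇒2≤len _   ¬xy (xy ∷ [])   = ⊥-elim (¬xy xy)
  non-adjacent⇒2≤len _   _   (_ ∷ _ ∷ _) = s≤s (s≤s z≤n)

  Shortest-2≤len⇒non-adjacent : ∀ {x y} {p : Walk (Adj G) x y} → Shortest G p → 2 ≤ len p →
                                x ≢ y × ¬ Adj G x y
  Shortest-2≤len⇒non-adjacent {x} {y} shortest 2≤p = x≢y , ¬xy
    where
    x≢y : x ≢ y
    x≢y refl with ≤-trans 2≤p (shortest [])
    ... | ()
    ¬xy : ¬ Adj G x y
    ¬xy xy with ≤-trans 2≤p (shortest (xy ∷ []))
    ... | s≤s ()

  DiameterTwo⇒Shortest-len≤2 : DiameterTwo → ∀ {x y} {p : Walk (Adj G) x y} →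
                               Shortest G p → len p ≤ 2
  DiameterTwo⇒Shortest-len≤2 diameter {x} {y} shortest with x ≟ y | Adj? x y
  ... | yes refl | _      = ≤-trans (shortest []) z≤n
  ... | no _     | yes xy = ≤-trans (shortest (xy ∷ [])) (s≤s z≤n)
  ... | no x≢y   | no ¬xy = let (_ , xw , wy) = diameter x y x≢y ¬xy
                            in ≤-trans (shortest (xw ∷ wy ∷ [])) (s≤s (s≤s z≤n))

  P₃Free? : Decidable P₃Free
  P₃Free? S = map′ (λ p₃ {x} {y} {z} → p₃ x y z) (λ p₃ x y z → p₃)
    (all? λ x → all? λ y → all? λ z → (x ∈? S) →-dec (y ∈? S) →-dec (z ∈? S) →-dec
      ¬? (x ≟ z) →-dec Adj? x y →-dec Adj? y z →-dec Adj? x z)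

  HasNonAdjacentPair? : Decidable HasNonAdjacentPair
  HasNonAdjacentPair? S = any? λ x → any? λ y →
    (x ∈? S) ×-dec (y ∈? S) ×-dec ¬? (x ≟ y) ×-dec ¬? (Adj? x y)

  HasNonAdjacentPair⊎IsClique : ∀ S → HasNonAdjacentPair S ⊎ IsClique G S
  HasNonAdjacentPair⊎IsClique S with HasNonAdjacentPair? S
  ... | yes pair = inj₁ pair
  ... | no ∄pair = inj₂ λ x y x∈S y∈S x≢y →
                     decidable-stable (Adj? x y) λ ¬xy → ∄pair (x , y , x∈S , y∈S , x≢y , ¬xy)

  HasNonAdjacentPair-mono : ∀ {S S′} → S ⊆ S′ → HasNonAdjacentPair S → HasNonAdjacentPair S′
  HasNonAdjacentPair-mono S⊆S′ (x , y , x∈S , y∈S , x≢y , ¬xy) =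
    x , y , S⊆S′ x∈S , S⊆S′ y∈S , x≢y , ¬xy

  HasNonAdjacentPair⇒¬IsClique : ∀ {S} → HasNonAdjacentPair S → ¬ IsClique G S
  HasNonAdjacentPair⇒¬IsClique (x , y , x∈S , y∈S , x≢y , ¬xy) clique =
    ¬xy (clique x y x∈S y∈S x≢y)

  IsClique⇒P₃Free : ∀ {S} → IsClique G S → P₃Free S
  IsClique⇒P₃Free clique {x} {_} {z} x∈S _ z∈S x≢z _ _ = clique x z x∈S z∈S x≢z

  ⁅⁆-IsClique : ∀ x → IsClique G ⁅ x ⁆
  ⁅⁆-IsClique x y z y∈⁅x⁆ z∈⁅x⁆ y≢z =
    ⊥-elim (y≢z (trans (x∈⁅y⁆⇒x≡y x y∈⁅x⁆) (≡-sym (x∈⁅y⁆⇒x≡y x z∈⁅x⁆))))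

  IsMaximalClique⇒Nonempty : Fin N → ∀ {S} → IsMaximalClique G S → Nonempty S
  IsMaximalClique⇒Nonempty x {S} (_ , maximal) with nonempty? S
  ... | yes nonempty = nonempty
  ... | no empty     = ⊥-elim (maximal ⁅ x ⁆ (Empty⇒⊂⁅⁆ x empty) (⁅⁆-IsClique x))

  IsUnionOfCliques⇒P₃Free : ∀ {S} → IsUnionOfCliques G S → P₃Free S
  IsUnionOfCliques⇒P₃Free cliques x∈S y∈S z∈S x≢z xy yz =
    cliques _ _ x∈S z∈S ((x∈S , y∈S , xy) ∷ (y∈S , z∈S , yz) ∷ []) x≢z

  P₃Free⇒IsUnionOfCliques : ∀ {S} → P₃Free S → IsUnionOfCliques G S
  P₃Free⇒IsUnionOfCliques p₃ x .x _ _ [] x≢x = ⊥-elim (x≢x refl)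
  P₃Free⇒IsUnionOfCliques p₃ x z x∈S z∈S (_∷_ {v = y} (_ , y∈S , xy) y⋯z) x≢z with y ≟ z
  ... | yes refl = xy
  ... | no y≢z   = p₃ x∈S y∈S z∈S x≢z xy (P₃Free⇒IsUnionOfCliques p₃ y z y∈S z∈S y⋯z y≢z)

  IsIUC⇒P₃Free : ∀ {S} → IsIUC G S → P₃Free S
  IsIUC⇒P₃Free = IsUnionOfCliques⇒P₃Free ∘ proj₁

  IsIUC⇒HasNonAdjacentPair : ∀ {S} → IsIUC G S → HasNonAdjacentPair S
  IsIUC⇒HasNonAdjacentPair (_ , x , y , x∈S , y∈S , x≁y) =
    x , y , x∈S , y∈S , (λ { refl → x≁y [] }) , (λ xy → x≁y ((x∈S , y∈S , xy) ∷ []))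

  P₃Free×HasNonAdjacentPair⇒IsIUC : ∀ {S} → P₃Free S → HasNonAdjacentPair S → IsIUC G S
  P₃Free×HasNonAdjacentPair⇒IsIUC p₃ (x , y , x∈S , y∈S , x≢y , ¬xy) =
    cliques , x , y , x∈S , y∈S , λ x⋯y → ¬xy (cliques x y x∈S y∈S x⋯y x≢y)
    where cliques = P₃Free⇒IsUnionOfCliques p₃

  IsIUC? : Decidable (IsIUC G)
  IsIUC? S = map′ to-IUC (λ iuc → IsIUC⇒P₃Free iuc , IsIUC⇒HasNonAdjacentPair iuc)
                  (P₃Free? S ×-dec HasNonAdjacentPair? S)
    where
    to-IUC : P₃Free S × HasNonAdjacentPair S → IsIUC G S
    to-IUC (p₃ , pair) = P₃Free×HasNonAdjacentPair⇒IsIUC p₃ pair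

  IsGP⇒P₃Free : ∀ {S} → IsGP G S → P₃Free S
  IsGP⇒P₃Free gp {x} {y} {z} x∈S y∈S z∈S x≢z xy yz with Adj? x z
  ... | yes xz = xz
  ... | no ¬xz = ⊥-elim (gp (xy ∷ yz ∷ []) (non-adjacent⇒2≤len x≢z ¬xz) x y z x∈S y∈S z∈S
                            (Adj⇒≢ xy) (Adj⇒≢ yz) x≢z here (there here) (there (there here)))

  -- Shortest paths have at most three vertices, so three distinct points of S on one are all of
  -- its vertices, and P₃-freeness would make its ends adjacent.
  P₃Free⇒IsGP : DiameterTwo → ∀ {S} → P₃Free S → IsGP G S
  P₃Free⇒IsGP diameter {S} p₃ p shortest =
    along p (DiameterTwo⇒Shortest-len≤2 diameter shortest) shortest
    where
    along : ∀ {u v} (p : Walk (Adj G) u v) → len p ≤ 2 → Shortest G p →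
      ∀ x y z → x ∈ S → y ∈ S → z ∈ S → x ≢ y → y ≢ z → x ≢ z →
      OnWalk x p → OnWalk y p → OnWalk z p → ⊥
    along [] _ _ _ _ _ _ _ _ x≢y _ _ here here _ = x≢y refl
    along (_ ∷ []) _ _ _ _ _ _ _ _ x≢y y≢z x≢z x∈p y∈p z∈p =
      no-three-distinct-in-pair (OnWalk-edge x∈p) (OnWalk-edge y∈p) (OnWalk-edge z∈p) x≢y y≢z x≢z
    along (uw ∷ wv ∷ []) _ shortest _ _ _ x∈S y∈S z∈S x≢y y≢z x≢z x∈p y∈p z∈p =
      let (u∈S , w∈S , v∈S) = three-distinct-fill-triple (_∈? S) x∈S y∈S z∈S x≢y y≢z x≢z
                                (OnWalk-path₂ x∈p) (OnWalk-path₂ y∈p) (OnWalk-path₂ z∈p)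
          (u≢v , ¬uv) = Shortest-2≤len⇒non-adjacent {p = uw ∷ wv ∷ []} shortest (s≤s (s≤s z≤n))
      in ¬uv (p₃ u∈S w∈S v∈S u≢v uw wv)
    along (_ ∷ _ ∷ _ ∷ _) (s≤s (s≤s ())) _ _ _ _ _ _ _ _ _ _ _ _ _

data _⊂²_ {n m : ℕ} : Subset n × Subset m → Subset n × Subset m → Set where
  ⊂ˡ : ∀ {A A′ B B′} → A ⊂ A′ → B ⊆ B′ → (A , B) ⊂² (A′ , B′)
  ⊂ʳ : ∀ {A A′ B B′} → A ⊆ A′ → B ⊂ B′ → (A , B) ⊂² (A′ , B′)

⊂²-swap : ∀ {n m} {A A′ : Subset n} {B B′ : Subset m} →
          (A , B) ⊂² (A′ , B′) → (B , A) ⊂² (B′ , A′)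
⊂²-swap (⊂ˡ A⊂A′ B⊆B′) = ⊂ʳ B⊆B′ A⊂A′
⊂²-swap (⊂ʳ A⊆A′ B⊂B′) = ⊂ˡ B⊂B′ A⊆A′

⊂²⇒⊆ˡ : ∀ {n m} {A A′ : Subset n} {B B′ : Subset m} → (A , B) ⊂² (A′ , B′) → A ⊆ A′
⊂²⇒⊆ˡ (⊂ˡ A⊂A′ _) = proj₁ A⊂A′
⊂²⇒⊆ˡ (⊂ʳ A⊆A′ _) = A⊆A′

module _ {n m : ℕ} (G : Graph n) (H : Graph m) where

  record IsGPPair (A : Subset n) (B : Subset m) : Set where
    field
      P₃Freeˡ : P₃Free G A
      P₃Freeʳ : P₃Free H B
      cliqueˡ : Nonempty B → IsClique G A
      cliqueʳ : Nonempty A → IsClique H B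

  record IsMaximalGPPair (A : Subset n) (B : Subset m) : Set where
    field
      isGPPair : IsGPPair A B
      maximal  : ∀ {A′ B′} → (A , B) ⊂² (A′ , B′) → ¬ IsGPPair A′ B′

open IsGPPair
open IsMaximalGPPair

IsGPPair-swap : ∀ {n m} {G : Graph n} {H : Graph m} {A B} →
                IsGPPair G H A B → IsGPPair H G B A
IsGPPair-swap gp = record
  { P₃Freeˡ = P₃Freeʳ gp ; P₃Freeʳ = P₃Freeˡ gp ; cliqueˡ = cliqueʳ gp ; cliqueʳ = cliqueˡ gp }

IsMaximalGPPair-swap : ∀ {n m} {G : Graph n} {H : Graph m} {A B} →
                       IsMaximalGPPair G H A B → IsMaximalGPPair H G B A
IsMaximalGPPair-swap max = record
  { isGPPair = IsGPPair-swap (isGPPair max)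
  ; maximal  = λ ext gp → maximal max (⊂²-swap ext) (IsGPPair-swap gp) }

cliques⇒IsGPPair : ∀ {n m} {G : Graph n} {H : Graph m} {A B} →
                   IsClique G A → IsClique H B → IsGPPair G H A B
cliques⇒IsGPPair {G = G} {H = H} cA cB = record
  { P₃Freeˡ = IsClique⇒P₃Free G cA ; P₃Freeʳ = IsClique⇒P₃Free H cB
  ; cliqueˡ = λ _ → cA             ; cliqueʳ = λ _ → cB }

P₃Free×Empty⇒IsGPPair : ∀ {n m} {G : Graph n} {H : Graph m} {A B} →
                        P₃Free G A → Empty B → IsGPPair G H A B
P₃Free×Empty⇒IsGPPair p₃ empty = record
  { P₃Freeˡ = p₃             ; P₃Freeʳ = λ x∈B → ⊥-elim (empty (_ , x∈B))
  ; cliqueˡ = ⊥-elim ∘ empty ; cliqueʳ = λ _ x _ x∈B → ⊥-elim (empty (x , x∈B)) }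

IsMaximalCliques⇒IsMaximalGPPair : ∀ {n m} {G : Graph n} {H : Graph m} → Fin n → Fin m →
  ∀ {A B} → IsMaximalClique G A → IsMaximalClique H B → IsMaximalGPPair G H A B
IsMaximalCliques⇒IsMaximalGPPair {G = G} {H = H} g h {A} {B} (cA , maxA) (cB , maxB) =
  record { isGPPair = cliques⇒IsGPPair cA cB ; maximal = blocked }
  where
  blocked : ∀ {A′ B′} → (A , B) ⊂² (A′ , B′) → ¬ IsGPPair G H A′ B′
  blocked (⊂ˡ A⊂A′ B⊆B′) gp =
    maxA _ A⊂A′ (cliqueˡ gp (map₂ B⊆B′ (IsMaximalClique⇒Nonempty H h (cB , maxB))))
  blocked (⊂ʳ A⊆A′ B⊂B′) gp =
    maxB _ B⊂B′ (cliqueʳ gp (map₂ A⊆A′ (IsMaximalClique⇒Nonempty G g (cA , maxA))))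

IsMaximalIUC⇒IsMaximalGPPair : ∀ {n m} {G : Graph n} {H : Graph m} {A} →
                               IsMaximalIUC G A → IsMaximalGPPair G H A ∅
IsMaximalIUC⇒IsMaximalGPPair {G = G} {H = H} {A} (iucA , maxA) =
  record { isGPPair = P₃Free×Empty⇒IsGPPair (IsIUC⇒P₃Free G iucA) ∅-Empty ; maximal = blocked }
  where
  pairA = IsIUC⇒HasNonAdjacentPair G iucA
  blocked : ∀ {A′ B′} → (A , ∅) ⊂² (A′ , B′) → ¬ IsGPPair G H A′ B′
  blocked {A′} {B′} ext gp with nonempty? B′ | ext
  ... | yes neB′   | _          = HasNonAdjacentPair⇒¬IsClique G
                                    (HasNonAdjacentPair-mono G (⊂²⇒⊆ˡ ext) pairA) (cliqueˡ gp neB′)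
  ... | no emptyB′ | ⊂ˡ A⊂A′ _ = maxA A′ A⊂A′ (P₃Free×HasNonAdjacentPair⇒IsIUC G (P₃Freeˡ gp)
                                    (HasNonAdjacentPair-mono G (proj₁ A⊂A′) pairA))
  ... | no emptyB′ | ⊂ʳ _ (_ , y , y∈B′ , _) = emptyB′ (y , y∈B′)

IsMaximalGPPair⇒IsMaximalCliqueˡ : ∀ {n m} {G : Graph n} {H : Graph m} {A B} →
  IsMaximalGPPair G H A B → Nonempty A → Nonempty B → IsMaximalClique G A
IsMaximalGPPair⇒IsMaximalCliqueˡ max neA neB = cliqueˡ gp neB , λ A′ A⊂A′ cA′ →
    maximal max (⊂ˡ A⊂A′ ⊆-refl) (cliques⇒IsGPPair cA′ (cliqueʳ gp neA))
  where gp = isGPPair max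

IsMaximalGPPair⇒IsMaximalIUCˡ : ∀ {n m} {G : Graph n} {H : Graph m} → Fin m → ∀ {A B} →
  IsMaximalGPPair G H A B → Empty B → IsMaximalIUC G A
IsMaximalGPPair⇒IsMaximalIUCˡ {G = G} {H = H} h {A} max emptyB =
    P₃Free×HasNonAdjacentPair⇒IsIUC G (P₃Freeˡ gp) pairA
  , λ A′ A⊂A′ iucA′ →
      maximal max (⊂ˡ A⊂A′ ⊆-refl) (P₃Free×Empty⇒IsGPPair (IsIUC⇒P₃Free G iucA′) emptyB)
  where
  gp = isGPPair max
  -- were A a clique, adding the single vertex h on the other side would give a larger GP pair
  pairA : HasNonAdjacentPair G A
  pairA with HasNonAdjacentPair⊎IsClique G A
  ... | inj₁ pair = pair
  ... | inj₂ cA   = ⊥-elim (maximal max (⊂ʳ ⊆-refl (Empty⇒⊂⁅⁆ h emptyB))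
                                      (cliques⇒IsGPPair cA (⁅⁆-IsClique H h)))

IsMaximalGPPair-cases : ∀ {n m} {G : Graph n} {H : Graph m} → Fin n → Fin m → ∀ {A B} →
  IsMaximalGPPair G H A B →
  (IsMaximalClique G A × IsMaximalClique H B) ⊎ IsMaximalIUC G A ⊎ IsMaximalIUC H B
IsMaximalGPPair-cases g h {A} {B} max with nonempty? A | nonempty? B
... | yes neA   | yes neB   = inj₁ ( IsMaximalGPPair⇒IsMaximalCliqueˡ max neA neB
                                   , IsMaximalGPPair⇒IsMaximalCliqueˡ swapped neB neA)
  where swapped = IsMaximalGPPair-swap max
... | _         | no emptyB = inj₂ (inj₁ (IsMaximalGPPair⇒IsMaximalIUCˡ h max emptyB))
... | no emptyA | _         =
  inj₂ (inj₂ (IsMaximalGPPair⇒IsMaximalIUCˡ g (IsMaximalGPPair-swap max) emptyA))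

data Side {n m : ℕ} : Fin (n + m) → Set where
  left  : (x : Fin n) → Side (x ↑ˡ m)
  right : (y : Fin m) → Side (n ↑ʳ y)

side : ∀ {n m} (i : Fin (n + m)) → Side i
side {n} i with splitAt n i in eq
... | inj₁ x = subst Side (splitAt⁻¹-↑ˡ eq) (left x)
... | inj₂ y = subst Side (splitAt⁻¹-↑ʳ eq) (right y)

∈-++⁺ˡ : ∀ {n m} {A : Subset n} {B : Subset m} {x} → x ∈ A → x ↑ˡ m ∈ A ++ B
∈-++⁺ˡ here      = here
∈-++⁺ˡ (there p) = there (∈-++⁺ˡ p)

∈-++⁻ˡ : ∀ {n m} {A : Subset n} {B : Subset m} {x} → x ↑ˡ m ∈ A ++ B → x ∈ A
∈-++⁻ˡ {A = _ ∷ _} {x = Fin.zero}  here      = here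
∈-++⁻ˡ {A = _ ∷ _} {x = Fin.suc _} (there p) = there (∈-++⁻ˡ p)

∈-++⁺ʳ : ∀ {n m} {A : Subset n} {B : Subset m} {y} → y ∈ B → n ↑ʳ y ∈ A ++ B
∈-++⁺ʳ {A = []}    p = p
∈-++⁺ʳ {A = _ ∷ A} p = there (∈-++⁺ʳ {A = A} p)

∈-++⁻ʳ : ∀ {n m} {A : Subset n} {B : Subset m} {y} → n ↑ʳ y ∈ A ++ B → y ∈ B
∈-++⁻ʳ {A = []}    p         = p
∈-++⁻ʳ {A = _ ∷ A} (there p) = ∈-++⁻ʳ {A = A} p

∣p++q∣≡∣p∣+∣q∣ : ∀ {n m} (p : Subset n) (q : Subset m) → ∣ p ++ q ∣ ≡ ∣ p ∣ + ∣ q ∣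
∣p++q∣≡∣p∣+∣q∣ []            q = refl
∣p++q∣≡∣p∣+∣q∣ (inside ∷ p)  q = cong suc (∣p++q∣≡∣p∣+∣q∣ p q)
∣p++q∣≡∣p∣+∣q∣ (outside ∷ p) q = ∣p++q∣≡∣p∣+∣q∣ p q

++-⊆⁺ : ∀ {n m} {A A′ : Subset n} {B B′ : Subset m} → A ⊆ A′ → B ⊆ B′ → A ++ B ⊆ A′ ++ B′
++-⊆⁺ {n} {m} A⊆A′ B⊆B′ {i} i∈A++B with side {n} {m} i
... | left _  = ∈-++⁺ˡ (A⊆A′ (∈-++⁻ˡ i∈A++B))
... | right _ = ∈-++⁺ʳ (B⊆B′ (∈-++⁻ʳ i∈A++B))

++-⊆⁻ : ∀ {n m} {A A′ : Subset n} {B B′ : Subset m} → A ++ B ⊆ A′ ++ B′ → A ⊆ A′ × B ⊆ B′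
++-⊆⁻ S⊆S′ = ∈-++⁻ˡ ∘ S⊆S′ ∘ ∈-++⁺ˡ , ∈-++⁻ʳ ∘ S⊆S′ ∘ ∈-++⁺ʳ

++-⊂⁺ : ∀ {n m} {A A′ : Subset n} {B B′ : Subset m} → (A , B) ⊂² (A′ , B′) → A ++ B ⊂ A′ ++ B′
++-⊂⁺ (⊂ˡ (A⊆A′ , _ , x∈A′ , x∉A) B⊆B′) = ++-⊆⁺ A⊆A′ B⊆B′ , _ , ∈-++⁺ˡ x∈A′ , x∉A ∘ ∈-++⁻ˡ
++-⊂⁺ (⊂ʳ A⊆A′ (B⊆B′ , _ , y∈B′ , y∉B)) = ++-⊆⁺ A⊆A′ B⊆B′ , _ , ∈-++⁺ʳ y∈B′ , y∉B ∘ ∈-++⁻ʳ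

++-⊂⁻ : ∀ {n m} {A A′ : Subset n} {B B′ : Subset m} → A ++ B ⊂ A′ ++ B′ → (A , B) ⊂² (A′ , B′)
++-⊂⁻ {n} {m} (S⊆S′ , i , i∈S′ , i∉S) with side {n} {m} i | ++-⊆⁻ S⊆S′
... | left x  | A⊆A′ , B⊆B′ = ⊂ˡ (A⊆A′ , x , ∈-++⁻ˡ i∈S′ , i∉S ∘ ∈-++⁺ˡ) B⊆B′
... | right y | A⊆A′ , B⊆B′ = ⊂ʳ A⊆A′ (B⊆B′ , y , ∈-++⁻ʳ i∈S′ , i∉S ∘ ∈-++⁺ʳ)

module _ {n m : ℕ} (G : Graph n) (H : Graph m) where

  Adj-↑ˡ⁺ : ∀ {x y} → Adj G x y → Adj (G ∨G H) (x ↑ˡ m) (y ↑ˡ m)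
  Adj-↑ˡ⁺ {x} {y} xy rewrite splitAt-↑ˡ n x m | splitAt-↑ˡ n y m = xy

  Adj-↑ˡ⁻ : ∀ {x y} → Adj (G ∨G H) (x ↑ˡ m) (y ↑ˡ m) → Adj G x y
  Adj-↑ˡ⁻ {x} {y} xy rewrite splitAt-↑ˡ n x m | splitAt-↑ˡ n y m = xy

  Adj-↑ʳ⁺ : ∀ {x y} → Adj H x y → Adj (G ∨G H) (n ↑ʳ x) (n ↑ʳ y)
  Adj-↑ʳ⁺ {x} {y} xy rewrite splitAt-↑ʳ n m x | splitAt-↑ʳ n m y = xy

  Adj-↑ʳ⁻ : ∀ {x y} → Adj (G ∨G H) (n ↑ʳ x) (n ↑ʳ y) → Adj H x y
  Adj-↑ʳ⁻ {x} {y} xy rewrite splitAt-↑ʳ n m x | splitAt-↑ʳ n m y = xy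

  Adj-↑ˡ↑ʳ : ∀ {x y} → Adj (G ∨G H) (x ↑ˡ m) (n ↑ʳ y)
  Adj-↑ˡ↑ʳ {x} {y} rewrite splitAt-↑ˡ n x m | splitAt-↑ʳ n m y = tt

  Adj-↑ʳ↑ˡ : ∀ {x y} → Adj (G ∨G H) (n ↑ʳ y) (x ↑ˡ m)
  Adj-↑ʳ↑ˡ {x} {y} rewrite splitAt-↑ˡ n x m | splitAt-↑ʳ n m y = tt

  ∨G-DiameterTwo : Fin n → Fin m → DiameterTwo (G ∨G H)
  ∨G-DiameterTwo g h i j _ ¬ij with side {n} {m} i | side {n} {m} j
  ... | left _  | left _  = n ↑ʳ h , Adj-↑ˡ↑ʳ , Adj-↑ʳ↑ˡ
  ... | right _ | right _ = g ↑ˡ m , Adj-↑ʳ↑ˡ , Adj-↑ˡ↑ʳ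
  ... | left _  | right _ = ⊥-elim (¬ij Adj-↑ˡ↑ʳ)
  ... | right _ | left _  = ⊥-elim (¬ij Adj-↑ʳ↑ˡ)

  P₃Free-++⇒IsGPPair : ∀ {A B} → P₃Free (G ∨G H) (A ++ B) → IsGPPair G H A B
  P₃Free-++⇒IsGPPair p₃ = record
    { P₃Freeˡ = λ x∈A y∈A z∈A x≢z xy yz → Adj-↑ˡ⁻ (p₃ (∈-++⁺ˡ x∈A) (∈-++⁺ˡ y∈A) (∈-++⁺ˡ z∈A)
                  (x≢z ∘ ↑ˡ-injective m _ _) (Adj-↑ˡ⁺ xy) (Adj-↑ˡ⁺ yz))
    ; P₃Freeʳ = λ x∈B y∈B z∈B x≢z xy yz → Adj-↑ʳ⁻ (p₃ (∈-++⁺ʳ x∈B) (∈-++⁺ʳ y∈B) (∈-++⁺ʳ z∈B)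
                  (x≢z ∘ ↑ʳ-injective n _ _) (Adj-↑ʳ⁺ xy) (Adj-↑ʳ⁺ yz))
    ; cliqueˡ = λ (_ , h∈B) x y x∈A y∈A x≢y → Adj-↑ˡ⁻ (p₃ (∈-++⁺ˡ x∈A) (∈-++⁺ʳ h∈B) (∈-++⁺ˡ y∈A)
                  (x≢y ∘ ↑ˡ-injective m _ _) Adj-↑ˡ↑ʳ Adj-↑ʳ↑ˡ)
    ; cliqueʳ = λ (_ , g∈A) x y x∈B y∈B x≢y → Adj-↑ʳ⁻ (p₃ (∈-++⁺ʳ x∈B) (∈-++⁺ˡ g∈A) (∈-++⁺ʳ y∈B)
                  (x≢y ∘ ↑ʳ-injective n _ _) Adj-↑ʳ↑ˡ Adj-↑ˡ↑ʳ)
    }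

  IsGPPair⇒P₃Free-++ : ∀ {A B} → IsGPPair G H A B → P₃Free (G ∨G H) (A ++ B)
  IsGPPair⇒P₃Free-++ gp {i} {j} {k} i∈S j∈S k∈S i≢k ij jk
    with side {n} {m} i | side {n} {m} j | side {n} {m} k
  ... | left x  | left _  | left z  = Adj-↑ˡ⁺ (P₃Freeˡ gp (∈-++⁻ˡ i∈S) (∈-++⁻ˡ j∈S) (∈-++⁻ˡ k∈S)
                                        (i≢k ∘ cong (_↑ˡ m)) (Adj-↑ˡ⁻ ij) (Adj-↑ˡ⁻ jk))
  ... | right x | right _ | right z = Adj-↑ʳ⁺ (P₃Freeʳ gp (∈-++⁻ʳ i∈S) (∈-++⁻ʳ j∈S) (∈-++⁻ʳ k∈S)
                                        (i≢k ∘ cong (n ↑ʳ_)) (Adj-↑ʳ⁻ ij) (Adj-↑ʳ⁻ jk))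
  ... | left x  | right y | left z  = Adj-↑ˡ⁺ (cliqueˡ gp (y , ∈-++⁻ʳ j∈S) x z
                                        (∈-++⁻ˡ i∈S) (∈-++⁻ˡ k∈S) (i≢k ∘ cong (_↑ˡ m)))
  ... | right x | left y  | right z = Adj-↑ʳ⁺ (cliqueʳ gp (y , ∈-++⁻ˡ j∈S) x z
                                        (∈-++⁻ʳ i∈S) (∈-++⁻ʳ k∈S) (i≢k ∘ cong (n ↑ʳ_)))
  ... | left _  | _       | right _ = Adj-↑ˡ↑ʳ
  ... | right _ | _       | left _  = Adj-↑ʳ↑ˡ

  IsGP-++⇒IsGPPair : ∀ {A B} → IsGP (G ∨G H) (A ++ B) → IsGPPair G H A B
  IsGP-++⇒IsGPPair = P₃Free-++⇒IsGPPair ∘ IsGP⇒P₃Free (G ∨G H)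

  IsGPPair⇒IsGP-++ : Fin n → Fin m → ∀ {A B} → IsGPPair G H A B → IsGP (G ∨G H) (A ++ B)
  IsGPPair⇒IsGP-++ g h = P₃Free⇒IsGP (G ∨G H) (∨G-DiameterTwo g h) ∘ IsGPPair⇒P₃Free-++

  IsMaximalGP-++⇒IsMaximalGPPair : Fin n → Fin m → ∀ {A B} →
    IsMaximalGP (G ∨G H) (A ++ B) → IsMaximalGPPair G H A B
  IsMaximalGP-++⇒IsMaximalGPPair g h (gp , maximal) = record
    { isGPPair = IsGP-++⇒IsGPPair gp
    ; maximal  = λ ext gpPair → maximal _ (++-⊂⁺ ext) (IsGPPair⇒IsGP-++ g h gpPair) }

  IsMaximalGPPair⇒IsMaximalGP-++ : Fin n → Fin m → ∀ {A B} →
    IsMaximalGPPair G H A B → IsMaximalGP (G ∨G H) (A ++ B)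
  IsMaximalGPPair⇒IsMaximalGP-++ g h max = IsGPPair⇒IsGP-++ g h (isGPPair max) , blocked
    where
    blocked : ∀ T → _ ⊂ T → ¬ IsGP (G ∨G H) T
    blocked T S⊂T gp with Vec.splitAt n T
    ... | A′ , B′ , refl = maximal max (++-⊂⁻ S⊂T) (IsGP-++⇒IsGPPair {A′} {B′} gp)

GPMinusTerm : ∀ {n m} → Graph n → Graph m → ℕ → ℕ → ℕ → Set
GPMinusTerm G H a b k = k ≡ a + b ⊎ SizeOf (IsMaximalIUC G) k ⊎ SizeOf (IsMaximalIUC H) k

GPMinusTerm? : ∀ {n m} (G : Graph n) (H : Graph m) a b → Decidable (GPMinusTerm G H a b)
GPMinusTerm? G H a b k =
  (k ≟ℕ a + b) ⊎-dec SizeOf? (Maximal? (IsIUC? G)) k ⊎-dec SizeOf? (Maximal? (IsIUC? H)) k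

module _ {n m} (G : Graph (suc n)) (H : Graph (suc m)) {a b}
         (ωG : IsOmegaMinus G a) (ωH : IsOmegaMinus H b) where

  GPMinusTerm⇒SizeOfMaximalGP : ∀ {k} → GPMinusTerm G H a b k → SizeOf (IsMaximalGP (G ∨G H)) k
  GPMinusTerm⇒SizeOfMaximalGP (inj₁ refl) =
    let (A , maxA , ∣A∣≡a) = proj₁ ωG
        (B , maxB , ∣B∣≡b) = proj₁ ωH
    in  A ++ B
      , IsMaximalGPPair⇒IsMaximalGP-++ G H zero zero
          (IsMaximalCliques⇒IsMaximalGPPair zero zero maxA maxB)
      , trans (∣p++q∣≡∣p∣+∣q∣ A B) (cong₂ _+_ ∣A∣≡a ∣B∣≡b)
  GPMinusTerm⇒SizeOfMaximalGP (inj₂ (inj₁ (A , maxA , refl))) =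
      A ++ ∅ {suc m}
    , IsMaximalGPPair⇒IsMaximalGP-++ G H zero zero (IsMaximalIUC⇒IsMaximalGPPair maxA)
    , trans (∣p++q∣≡∣p∣+∣q∣ A ∅) (trans (cong (∣ A ∣ +_) (∣⊥∣≡0 (suc m))) (+-identityʳ _))
  GPMinusTerm⇒SizeOfMaximalGP (inj₂ (inj₂ (B , maxB , refl))) =
      ∅ {suc n} ++ B
    , IsMaximalGPPair⇒IsMaximalGP-++ G H zero zero
        (IsMaximalGPPair-swap (IsMaximalIUC⇒IsMaximalGPPair maxB))
    , trans (∣p++q∣≡∣p∣+∣q∣ (∅ {suc n}) B) (cong (_+ ∣ B ∣) (∣⊥∣≡0 (suc n)))

  SizeOfMaximalGP⇒GPMinusTerm≤ : ∀ {j} → SizeOf (IsMaximalGP (G ∨G H)) j →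
                                 ∃ λ k → GPMinusTerm G H a b k × k ≤ j
  SizeOfMaximalGP⇒GPMinusTerm≤ (S , maxS , refl) with Vec.splitAt (suc n) S
  ... | A , B , refl =
    let (k , term , k≤) = bound (IsMaximalGPPair-cases zero zero
                                   (IsMaximalGP-++⇒IsMaximalGPPair G H zero zero maxS))
    in  k , term , subst (k ≤_) (≡-sym (∣p++q∣≡∣p∣+∣q∣ A B)) k≤
    where
    bound : (IsMaximalClique G A × IsMaximalClique H B) ⊎ IsMaximalIUC G A ⊎ IsMaximalIUC H B →
            ∃ λ k → GPMinusTerm G H a b k × k ≤ ∣ A ∣ + ∣ B ∣
    bound (inj₁ (maxA , maxB)) =
      a + b , inj₁ refl , +-mono-≤ (proj₂ ωG _ (A , maxA , refl)) (proj₂ ωH _ (B , maxB , refl))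
    bound (inj₂ (inj₁ maxA)) = ∣ A ∣ , inj₂ (inj₁ (A , maxA , refl)) , m≤m+n _ _
    bound (inj₂ (inj₂ maxB)) = ∣ B ∣ , inj₂ (inj₂ (B , maxB , refl)) , m≤n+m _ _

lemma3p1 : ∀ {n m} (G : Graph (suc n)) (H : Graph (suc m)) (a b : ℕ) →
    IsOmegaMinus G a → IsOmegaMinus H b →
    Σ ℕ λ g → IsGPMinus (G ∨G H) g ×
      IsLeast (λ k → k ≡ a + b ⊎ SizeOf (IsMaximalIUC G) k ⊎ SizeOf (IsMaximalIUC H) k) g
lemma3p1 G H a b ωG ωH =
  let (g , g-least) = least (GPMinusTerm? G H a b) (inj₁ refl)
  in  g
    , IsLeast-transfer (GPMinusTerm⇒SizeOfMaximalGP G H ωG ωH)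
                       (SizeOfMaximalGP⇒GPMinusTerm≤ G H ωG ωH) g-least
    , g-least
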